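{- The rewrite rule $$N(x) \longrightarrow \forall p~(0 \in p \Rightarrow (\forall y~(N(y) \Rightarrow y\in p \Rightarrow S(y) \in p)) \Rightarrow x \in p)$$ is valid in the pre-model described below, i.e. for every natural number $n$, $P_n$ equals the interpretation of $\forall p~(0\in p\Rightarrow(\forall y~(N(y) \Rightarrow y\in p\Rightarrow S(y)\in p)) \Rightarrow x\in p)$ under the assignment $n/x$.
   Context: Setting: deduction modulo, proof-terms, reduction $\triangleright$, reducibility candidates; ${\cal SN}$ the set of strongly normalizing proof-terms; for a set $A$ of ${\cal SN}$ proof-terms, $[A]$ is the least candidate containing $A$. For proof-terms $\sigma_0,\sigma_S$ and a sequence $P=(P_i)_{i\in\mathbb N}$ of candidates: $C_0^{\sigma_0,\sigma_S,P}=[\{\sigma_0\}\cap{\cal SN}]$ and $C_{n+1}^{\sigma_0,\sigma_S,P}=[\{(\sigma_S~t~\rho~\pi)\in{\cal SN}\mid \rho\in P_n,\ \pi\in C_n^{\sigma_0,\sigma_S,P}\}]$. $\langle\sigma_0,\sigma_S\rangle$ is a $P$-Peano pair if $\sigma_0,\sigma_S\in{\cal SN}$ and for every term $t$, every $n$, every $\rho\in P_n$ and every $\pi\in C_n^{\sigma_0,\sigma_S,P}$, $(\sigma_S~t~\rho~\pi)$ is ${\cal SN}$. $\Phi(P)_n=\{\pi\in{\cal SN}\mid \forall t\,\forall\sigma_0\,\forall\sigma_S~(\langle\sigma_0,\sigma_S\rangle \text{ is a } P\text{ -Peano pair}\Rightarrow(\pi~t~\sigma_0~\sigma_S)\in C_n^{\sigma_0,\sigma_S,P})\}$;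 $\Phi$ is monotone and $P=(P_n)$ is its least fixpoint; "Peano pair" and $C_n^{\sigma_0,\sigma_S}$ refer to this $P$. The pre-model of $\mbox{HA}_{\longrightarrow}$ (two sorts $\iota,\kappa$): $M_\iota=\mathbb N$ with obvious $0,S,+,\times,\mathit{Pred}$; $\mathit{Null}$ interpreted as ${\cal SN}$; $=$ interpreted by candidates $E$ (equal arguments) and $E'$ (distinct arguments); $N(n)$ interpreted by $P_n$; $M_\kappa$ is the countable set of functions $\mathbb N\to$ candidates containing definable functions, constant functions with value $C_\sigma=[\{\sigma\}]$, and the functions $k\mapsto C_k^{\sigma_0,\sigma_S}$; $\in$ is interpreted by application. The interpretation of $\forall p~A$ consists of ${\cal SN}$ proof-terms $\pi$ such that for every term $t$ and every $f\in M_\kappa$, $(\pi~t)$ lies in the interpretation of $A$ under $f/p$; $\forall y$ over sort $\iota$ similarly ranges over $n\in\mathbb N$; implication is interpreted as usual (application maps the antecedent's candidate into the consequent's). -}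

module Defs where

open import Level using (Level; _⊔_) renaming (suc to lsuc; zero to lzero)
open import Data.Nat using (ℕ; zero; suc; pred; _<ᵇ_)
open import Data.Bool using (if_then_else_)
open import Data.List using (List; []; _∷_)
open import Data.Product using (Σ; _×_; _,_; ∃-syntax)
open import Relation.Binary.PropositionalEquality using (_≡_)
open import Function.Bundles using (_⇔_)

-- First-order terms (de Bruijn indexed variables, arbitrary function
-- symbols coded by natural numbers).  Proof reduction never inspects
-- terms; they are only carried around and substituted.

data Term : Set where
  var : ℕ → Term
  fun : ℕ → List Term → Term

mutual
  shiftᵗ : ℕ → Term → Term
  shiftᵗ c (var x)    = var (if x <ᵇ c then x else suc x)
  shiftᵗ c (fun f ts) = fun f (shiftsᵗ c ts)

  shiftsᵗ : ℕ → List Term → List Term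
  shiftsᵗ c []       = []
  shiftsᵗ c (t ∷ ts) = shiftᵗ c t ∷ shiftsᵗ c ts

mutual
  substᵗ : ℕ → Term → Term → Term
  substᵗ j u (var x)    = if x <ᵇ j then var x else (if j <ᵇ x then var (pred x) else u)
  substᵗ j u (fun f ts) = fun f (substsᵗ j u ts)

  substsᵗ : ℕ → Term → List Term → List Term
  substsᵗ j u []       = []
  substsᵗ j u (t ∷ ts) = substᵗ j u t ∷ substsᵗ j u ts

-- Proof-terms of natural deduction modulo (Dowek–Werner), Curry style,
-- with two separate de Bruijn namespaces: proof variables and term variables.

data PTerm : Set where
  pvar    : ℕ → PTerm
  lam     : PTerm → PTerm                 -- λα π        (binds a proof var)
  app     : PTerm → PTerm → PTerm
  tlam    : PTerm → PTerm                 -- λx π        (binds a term var)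
  tapp    : PTerm → Term → PTerm
  pair    : PTerm → PTerm → PTerm
  fst     : PTerm → PTerm
  snd     : PTerm → PTerm
  inl     : PTerm → PTerm
  inr     : PTerm → PTerm
  case    : PTerm → PTerm → PTerm → PTerm -- δ(π, απ₁, βπ₂) (branches bind a proof var)
  wit     : Term → PTerm → PTerm
  exElim  : PTerm → PTerm → PTerm         -- δ∃(π, xαπ') (branch binds term var x and proof var α)
  botElim : PTerm → PTerm
  unit    : PTerm

shiftᵖ : ℕ → PTerm → PTerm
shiftᵖ c (pvar x)     = pvar (if x <ᵇ c then x else suc x)
shiftᵖ c (lam π)      = lam (shiftᵖ (suc c) π)
shiftᵖ c (app π ρ)    = app (shiftᵖ c π) (shiftᵖ c ρ)
shiftᵖ c (tlam π)     = tlam (shiftᵖ c π)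
shiftᵖ c (tapp π t)   = tapp (shiftᵖ c π) t
shiftᵖ c (pair π ρ)   = pair (shiftᵖ c π) (shiftᵖ c ρ)
shiftᵖ c (fst π)      = fst (shiftᵖ c π)
shiftᵖ c (snd π)      = snd (shiftᵖ c π)
shiftᵖ c (inl π)      = inl (shiftᵖ c π)
shiftᵖ c (inr π)      = inr (shiftᵖ c π)
shiftᵖ c (case π a b) = case (shiftᵖ c π) (shiftᵖ (suc c) a) (shiftᵖ (suc c) b)
shiftᵖ c (wit t π)    = wit t (shiftᵖ c π)
shiftᵖ c (exElim π a) = exElim (shiftᵖ c π) (shiftᵖ (suc c) a)
shiftᵖ c (botElim π)  = botElim (shiftᵖ c π)
shiftᵖ c unit         = unit

shiftᵗᵖ : ℕ → PTerm → PTerm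
shiftᵗᵖ c (pvar x)     = pvar x
shiftᵗᵖ c (lam π)      = lam (shiftᵗᵖ c π)
shiftᵗᵖ c (app π ρ)    = app (shiftᵗᵖ c π) (shiftᵗᵖ c ρ)
shiftᵗᵖ c (tlam π)     = tlam (shiftᵗᵖ (suc c) π)
shiftᵗᵖ c (tapp π t)   = tapp (shiftᵗᵖ c π) (shiftᵗ c t)
shiftᵗᵖ c (pair π ρ)   = pair (shiftᵗᵖ c π) (shiftᵗᵖ c ρ)
shiftᵗᵖ c (fst π)      = fst (shiftᵗᵖ c π)
shiftᵗᵖ c (snd π)      = snd (shiftᵗᵖ c π)
shiftᵗᵖ c (inl π)      = inl (shiftᵗᵖ c π)
shiftᵗᵖ c (inr π)      = inr (shiftᵗᵖ c π)
shiftᵗᵖ c (case π a b) = case (shiftᵗᵖ c π) (shiftᵗᵖ c a) (shiftᵗᵖ c b)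
shiftᵗᵖ c (wit t π)    = wit (shiftᵗ c t) (shiftᵗᵖ c π)
shiftᵗᵖ c (exElim π a) = exElim (shiftᵗᵖ c π) (shiftᵗᵖ (suc c) a)
shiftᵗᵖ c (botElim π)  = botElim (shiftᵗᵖ c π)
shiftᵗᵖ c unit         = unit

substᵖ : ℕ → PTerm → PTerm → PTerm
substᵖ j ρ (pvar x)     = if x <ᵇ j then pvar x else (if j <ᵇ x then pvar (pred x) else ρ)
substᵖ j ρ (lam π)      = lam (substᵖ (suc j) (shiftᵖ 0 ρ) π)
substᵖ j ρ (app π σ)    = app (substᵖ j ρ π) (substᵖ j ρ σ)
substᵖ j ρ (tlam π)     = tlam (substᵖ j (shiftᵗᵖ 0 ρ) π)
substᵖ j ρ (tapp π t)   = tapp (substᵖ j ρ π) t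
substᵖ j ρ (pair π σ)   = pair (substᵖ j ρ π) (substᵖ j ρ σ)
substᵖ j ρ (fst π)      = fst (substᵖ j ρ π)
substᵖ j ρ (snd π)      = snd (substᵖ j ρ π)
substᵖ j ρ (inl π)      = inl (substᵖ j ρ π)
substᵖ j ρ (inr π)      = inr (substᵖ j ρ π)
substᵖ j ρ (case π a b) = case (substᵖ j ρ π) (substᵖ (suc j) (shiftᵖ 0 ρ) a) (substᵖ (suc j) (shiftᵖ 0 ρ) b)
substᵖ j ρ (wit t π)    = wit t (substᵖ j ρ π)
substᵖ j ρ (exElim π a) = exElim (substᵖ j ρ π) (substᵖ (suc j) (shiftᵖ 0 (shiftᵗᵖ 0 ρ)) a)
substᵖ j ρ (botElim π)  = botElim (substᵖ j ρ π)
substᵖ j ρ unit         = unit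

substᵗᵖ : ℕ → Term → PTerm → PTerm
substᵗᵖ j u (pvar x)     = pvar x
substᵗᵖ j u (lam π)      = lam (substᵗᵖ j u π)
substᵗᵖ j u (app π σ)    = app (substᵗᵖ j u π) (substᵗᵖ j u σ)
substᵗᵖ j u (tlam π)     = tlam (substᵗᵖ (suc j) (shiftᵗ 0 u) π)
substᵗᵖ j u (tapp π t)   = tapp (substᵗᵖ j u π) (substᵗ j u t)
substᵗᵖ j u (pair π σ)   = pair (substᵗᵖ j u π) (substᵗᵖ j u σ)
substᵗᵖ j u (fst π)      = fst (substᵗᵖ j u π)
substᵗᵖ j u (snd π)      = snd (substᵗᵖ j u π)
substᵗᵖ j u (inl π)      = inl (substᵗᵖ j u π)
substᵗᵖ j u (inr π)      = inr (substᵗᵖ j u π)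
substᵗᵖ j u (case π a b) = case (substᵗᵖ j u π) (substᵗᵖ j u a) (substᵗᵖ j u b)
substᵗᵖ j u (wit t π)    = wit (substᵗ j u t) (substᵗᵖ j u π)
substᵗᵖ j u (exElim π a) = exElim (substᵗᵖ j u π) (substᵗᵖ (suc j) (shiftᵗ 0 u) a)
substᵗᵖ j u (botElim π)  = botElim (substᵗᵖ j u π)
substᵗᵖ j u unit         = unit

infix 4 _▷_
data _▷_ : PTerm → PTerm → Set where
  β-lam   : ∀ {π ρ} → app (lam π) ρ ▷ substᵖ 0 ρ π
  β-tlam  : ∀ {π t} → tapp (tlam π) t ▷ substᵗᵖ 0 t π
  β-fst   : ∀ {π ρ} → fst (pair π ρ) ▷ π
  β-snd   : ∀ {π ρ} → snd (pair π ρ) ▷ ρ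
  β-inl   : ∀ {π a b} → case (inl π) a b ▷ substᵖ 0 π a
  β-inr   : ∀ {π a b} → case (inr π) a b ▷ substᵖ 0 π b
  β-ex    : ∀ {t π a} → exElim (wit t π) a ▷ substᵖ 0 π (substᵗᵖ 0 t a)
  ξ-lam   : ∀ {π π'} → π ▷ π' → lam π ▷ lam π'
  ξ-appˡ  : ∀ {π π' ρ} → π ▷ π' → app π ρ ▷ app π' ρ
  ξ-appʳ  : ∀ {π ρ ρ'} → ρ ▷ ρ' → app π ρ ▷ app π ρ'
  ξ-tlam  : ∀ {π π'} → π ▷ π' → tlam π ▷ tlam π'
  ξ-tapp  : ∀ {π π' t} → π ▷ π' → tapp π t ▷ tapp π' t
  ξ-pairˡ : ∀ {π π' ρ} → π ▷ π' → pair π ρ ▷ pair π' ρ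
  ξ-pairʳ : ∀ {π ρ ρ'} → ρ ▷ ρ' → pair π ρ ▷ pair π ρ'
  ξ-fst   : ∀ {π π'} → π ▷ π' → fst π ▷ fst π'
  ξ-snd   : ∀ {π π'} → π ▷ π' → snd π ▷ snd π'
  ξ-inl   : ∀ {π π'} → π ▷ π' → inl π ▷ inl π'
  ξ-inr   : ∀ {π π'} → π ▷ π' → inr π ▷ inr π'
  ξ-case₀ : ∀ {π π' a b} → π ▷ π' → case π a b ▷ case π' a b
  ξ-case₁ : ∀ {π a a' b} → a ▷ a' → case π a b ▷ case π a' b
  ξ-case₂ : ∀ {π a b b'} → b ▷ b' → case π a b ▷ case π a b'
  ξ-wit   : ∀ {t π π'} → π ▷ π' → wit t π ▷ wit t π'
  ξ-ex₀   : ∀ {π π' a} → π ▷ π' → exElim π a ▷ exElim π' a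
  ξ-ex₁   : ∀ {π a a'} → a ▷ a' → exElim π a ▷ exElim π a'
  ξ-bot   : ∀ {π π'} → π ▷ π' → botElim π ▷ botElim π'

data SN (π : PTerm) : Set where
  sn : (∀ {π'} → π ▷ π' → SN π') → SN π

data Neutral : PTerm → Set where
  n-var  : ∀ {x} → Neutral (pvar x)
  n-app  : ∀ {π ρ} → Neutral (app π ρ)
  n-tapp : ∀ {π t} → Neutral (tapp π t)
  n-fst  : ∀ {π} → Neutral (fst π)
  n-snd  : ∀ {π} → Neutral (snd π)
  n-case : ∀ {π a b} → Neutral (case π a b)
  n-ex   : ∀ {π a} → Neutral (exElim π a)
  n-bot  : ∀ {π} → Neutral (botElim π)

Pred : Set₁
Pred = PTerm → Set

_⊆_ : ∀ {a b} → (PTerm → Set a) → (PTerm → Set b) → Set (a ⊔ b)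
A ⊆ B = ∀ {π} → A π → B π

record IsCandidate {a} (R : PTerm → Set a) : Set a where
  field
    CR1 : R ⊆ SN
    CR2 : ∀ {π π'} → R π → π ▷ π' → R π'
    CR3 : ∀ {π} → Neutral π → (∀ {π'} → π ▷ π' → R π') → R π

-- [ A ] : the least candidate containing A (for A ⊆ SN), given as the
-- inductive closure of A under the candidate conditions; see
-- [ ]-isCandidate and [ ]-least below.
data [_] (A : Pred) : Pred where
  inc : ∀ {π} → A π → [ A ] π
  red : ∀ {π π'} → [ A ] π → π ▷ π' → [ A ] π'
  neu : ∀ {π} → Neutral π → (∀ {π'} → π ▷ π' → [ A ] π') → [ A ] π

SN-red : ∀ {π π'} → SN π → π ▷ π' → SN π'
SN-red (sn h) r = h r

[]⊆SN : ∀ {A} → A ⊆ SN → [ A ] ⊆ SN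
[]⊆SN h (inc a)   = h a
[]⊆SN h (red x r) = SN-red ([]⊆SN h x) r
[]⊆SN h (neu n k) = sn (λ r → []⊆SN h (k r))

[]-isCandidate : ∀ {A} → A ⊆ SN → IsCandidate [ A ]
[]-isCandidate h = record { CR1 = []⊆SN h ; CR2 = red ; CR3 = neu }

[]-least : ∀ {a} {A : Pred} {R : PTerm → Set a} → IsCandidate R → A ⊆ R → [ A ] ⊆ R
[]-least c h (inc x)   = h x
[]-least c h (red x r) = IsCandidate.CR2 c ([]-least c h x) r
[]-least c h (neu n k) = IsCandidate.CR3 c n (λ r → []-least c h (k r))

app3 : PTerm → Term → PTerm → PTerm → PTerm
app3 σ t ρ π = app (app (tapp σ t) ρ) π

C : (ℕ → Pred) → PTerm → PTerm → ℕ → Pred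
C P σ₀ σS zero    = [ (λ π → (π ≡ σ₀) × SN π) ]
C P σ₀ σS (suc n) =
  [ (λ π → (Σ Term λ t → Σ PTerm λ ρ → Σ PTerm λ π' →
              (π ≡ app3 σS t ρ π') × P n ρ × C P σ₀ σS n π') × SN π) ]

PeanoPair : (ℕ → Pred) → PTerm → PTerm → Set
PeanoPair P σ₀ σS =
  SN σ₀ × SN σS ×
  (∀ (t : Term) (n : ℕ) ρ π → P n ρ → C P σ₀ σS n π → SN (app3 σS t ρ π))

Φ : (ℕ → Pred) → ℕ → Pred
Φ P n π = SN π × (∀ (t : Term) σ₀ σS → PeanoPair P σ₀ σS →
                   C P σ₀ σS n (app (app (tapp π t) σ₀) σS))

IsLeastFixpointΦ : (ℕ → Pred) → Set₁
IsLeastFixpointΦ P =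
  (∀ n → IsCandidate (P n)) ×
  (∀ n π → P n π ⇔ Φ P n π) ×
  (∀ (Q : ℕ → Pred) → (∀ n → IsCandidate (Q n)) → (∀ n π → Q n π ⇔ Φ Q n π) →
     ∀ n → P n ⊆ Q n)

Arrow : ∀ {a b} → (PTerm → Set a) → (PTerm → Set b) → PTerm → Set (a ⊔ b)
Arrow R S π = SN π × (∀ ρ → R ρ → S (app π ρ))

Forallι : ∀ {a} → (ℕ → PTerm → Set a) → PTerm → Set a
Forallι F π = SN π × (∀ (t : Term) (n : ℕ) → F n (tapp π t))

Forallκ : ((ℕ → Pred) → Set₁) → ((ℕ → Pred) → Pred) → PTerm → Set₁
Forallκ Mκ F π = SN π × (∀ (t : Term) (f : ℕ → Pred) → Mκ f → F f (tapp π t))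

MκSpec : (ℕ → Pred) → ((ℕ → Pred) → Set₁) → Set₁
MκSpec P Mκ =
  (∀ f → Mκ f → ∀ k → IsCandidate (f k)) ×
  (∀ σ → SN σ → Mκ (λ _ → [ (λ π → π ≡ σ) ])) ×
  (∀ σ₀ σS → Mκ (λ k → C P σ₀ σS k))

-- Interpretation of
--   ∀p (0 ∈ p ⇒ (∀y (N(y) ⇒ y ∈ p ⇒ S(y) ∈ p)) ⇒ x ∈ p)
-- under n/x, where N(m) ↦ P m, (m ∈ p) ↦ f m under f/p, 0 ↦ 0, S ↦ suc.
⟦Nrhs⟧ : (ℕ → Pred) → ((ℕ → Pred) → Set₁) → ℕ → PTerm → Set₁
⟦Nrhs⟧ P Mκ n =
  Forallκ Mκ (λ f →
    Arrow (f 0)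
      (Arrow (Forallι (λ m → Arrow (P m) (Arrow (f m) (f (suc m)))))
             (f n)))

-- P_n is by definition the set of strongly normalizing π with (π t σ₀ σS) ∈ C_n^{σ₀,σS} for
-- every Peano pair ⟨σ₀,σS⟩, while the right-hand side asks (π t ρ₀ ρS) ∈ f n for every
-- f ∈ M_κ, ρ₀ ∈ f 0 and successor ρS for f.  The two meet because C^{σ₀,σS} is the least
-- family of candidates containing σ₀ at 0 and closed under σS: induction data (f, ρ₀, ρS)
-- therefore form a Peano pair whose C is below f, and conversely a Peano pair ⟨σ₀,σS⟩ is
-- induction data for the family C^{σ₀,σS}, which belongs to M_κ.  Only the fixpoint
-- equation P = Φ(P) is used, not its leastness.
module Submission where

open import Defs
open import Data.Nat using (ℕ; zero; suc)
open import Data.Product using (_,_; proj₁; proj₂)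
open import Function.Bundles using (_⇔_; mk⇔; Equivalence)
open import Relation.Binary.PropositionalEquality using (refl)

SN-appˡ : ∀ {π ρ} → SN (app π ρ) → SN π
SN-appˡ (sn h) = sn (λ r → SN-appˡ (h (ξ-appˡ r)))

SN-pvar : ∀ {x} → SN (pvar x)
SN-pvar = sn (λ ())

pvar∈candidate : ∀ {a} {R : PTerm → Set a} {x} → IsCandidate R → R (pvar x)
pvar∈candidate c = IsCandidate.CR3 c n-var (λ ())

SN-app3-pvar : ∀ {x t ρ π} → SN ρ → SN π → SN (app3 (pvar x) t ρ π)
SN-app3-pvar snρ@(sn ρ-red) snπ@(sn π-red) = sn λ where
  (ξ-appˡ (ξ-appˡ (ξ-tapp ())))
  (ξ-appˡ (ξ-appʳ r)) → SN-app3-pvar (ρ-red r) snπ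
  (ξ-appʳ r)          → SN-app3-pvar snρ (π-red r)

C-isCandidate : ∀ P σ₀ σS k → IsCandidate (C P σ₀ σS k)
C-isCandidate P σ₀ σS zero    = []-isCandidate proj₂
C-isCandidate P σ₀ σS (suc k) = []-isCandidate proj₂

-- The hypothesis ∀y (N(y) ⇒ y ∈ p ⇒ S(y) ∈ p) of the rewrite rule, interpreted under R/p.
IsSuccessor : (ℕ → Pred) → (ℕ → Pred) → PTerm → Set
IsSuccessor P R = Forallι (λ m → Arrow (P m) (Arrow (R m) (R (suc m))))

successor-step : ∀ {P R σS t m ρ π} → IsSuccessor P R σS →
                 P m ρ → R m π → R (suc m) (app3 σS t ρ π)
successor-step {t = t} {m} {ρ} {π} step ρ∈P π∈R =
  proj₂ (proj₂ (proj₂ step t m) ρ ρ∈P) π π∈R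

C-least : ∀ {P R σ₀ σS} → (∀ k → IsCandidate (R k)) → R 0 σ₀ → IsSuccessor P R σS →
          ∀ k → C P σ₀ σS k ⊆ R k
C-least candR σ₀∈R step zero    = []-least (candR zero) λ { (refl , _) → σ₀∈R }
C-least candR σ₀∈R step (suc k) = []-least (candR (suc k))
  λ { ((_ , _ , _ , refl , ρ∈P , π∈C) , _) →
        successor-step step ρ∈P (C-least candR σ₀∈R step k π∈C) }

successor⇒PeanoPair : ∀ {P R σ₀ σS} → (∀ k → IsCandidate (R k)) → R 0 σ₀ →
                      IsSuccessor P R σS → PeanoPair P σ₀ σS
successor⇒PeanoPair candR σ₀∈R step =
  IsCandidate.CR1 (candR 0) σ₀∈R , proj₁ step ,
  λ t m ρ π ρ∈P π∈C → IsCandidate.CR1 (candR (suc m))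
    (successor-step step ρ∈P (C-least candR σ₀∈R step m π∈C))

pvar-PeanoPair : ∀ {P σ₀ x} → (∀ m → IsCandidate (P m)) → SN σ₀ → PeanoPair P σ₀ (pvar x)
pvar-PeanoPair {P} {σ₀} candP snσ₀ = snσ₀ , SN-pvar ,
  λ t m ρ π ρ∈P π∈C → SN-app3-pvar (IsCandidate.CR1 (candP m) ρ∈P)
                                   (IsCandidate.CR1 (C-isCandidate P σ₀ _ m) π∈C)

PeanoPair⇒zero : ∀ {P σ₀ σS} → PeanoPair P σ₀ σS → C P σ₀ σS 0 σ₀
PeanoPair⇒zero (snσ₀ , _) = inc (refl , snσ₀)

-- The successor condition needs SN of the partial applications (σS t) and (σS t ρ); they
-- are read off the full applications to variables, which lie in every candidate.
PeanoPair⇒IsSuccessor : ∀ {P σ₀ σS} → (∀ m → IsCandidate (P m)) → PeanoPair P σ₀ σS →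
                        IsSuccessor P (C P σ₀ σS) σS
PeanoPair⇒IsSuccessor {P} {σ₀} {σS} candP (_ , snσS , closed) = snσS , λ t m →
  SN-appˡ (SN-appˡ (closed t m (pvar 0) _ (pvar∈candidate (candP m)) (var∈C m))) ,
  λ ρ ρ∈P → SN-appˡ (closed t m ρ _ ρ∈P (var∈C m)) ,
  λ π π∈C → inc ((t , ρ , π , refl , ρ∈P , π∈C) , closed t m ρ π ρ∈P π∈C)
  where
  var∈C : ∀ m → C P σ₀ σS m (pvar 0)
  var∈C m = pvar∈candidate (C-isCandidate P σ₀ σS m)

Φ-app3-SN : ∀ {P n π t σ₀ σS} → Φ P n π → PeanoPair P σ₀ σS → SN (app3 π t σ₀ σS)
Φ-app3-SN {P} {n} {t = t} (_ , inC) pp = IsCandidate.CR1 (C-isCandidate P _ _ n) (inC t _ _ pp)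

Φ⊆⟦Nrhs⟧ : ∀ {P Mκ} → (∀ m → IsCandidate (P m)) → (∀ f → Mκ f → ∀ k → IsCandidate (f k)) →
           ∀ n → Φ P n ⊆ ⟦Nrhs⟧ P Mκ n
Φ⊆⟦Nrhs⟧ candP candMκ n φ@(snπ , inC) = snπ , λ t f f∈Mκ →
  SN-appˡ (SN-appˡ (Φ-app3-SN {t = t} φ (pvar-PeanoPair {x = 0} candP (SN-pvar {0})))) ,
  λ ρ₀ ρ₀∈f → SN-appˡ (Φ-app3-SN φ (pvar-PeanoPair {x = 0} candP
                                       (IsCandidate.CR1 (candMκ f f∈Mκ 0) ρ₀∈f))) ,
  λ ρS step → C-least (candMκ f f∈Mκ) ρ₀∈f step n
                (inC t ρ₀ ρS (successor⇒PeanoPair (candMκ f f∈Mκ) ρ₀∈f step))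

⟦Nrhs⟧⊆Φ : ∀ {P Mκ} → (∀ m → IsCandidate (P m)) → (∀ σ₀ σS → Mκ (C P σ₀ σS)) →
           ∀ n → ⟦Nrhs⟧ P Mκ n ⊆ Φ P n
⟦Nrhs⟧⊆Φ {P} candP C∈Mκ n (snπ , elim) = snπ , λ t σ₀ σS pp →
  proj₂ (proj₂ (elim t (C P σ₀ σS) (C∈Mκ σ₀ σS)) σ₀ (PeanoPair⇒zero pp)) σS
        (PeanoPair⇒IsSuccessor candP pp)

proposition20 : (P : ℕ → Pred) → IsLeastFixpointΦ P →
                (Mκ : (ℕ → Pred) → Set₁) → MκSpec P Mκ →
                ∀ (n : ℕ) (π : PTerm) → P n π ⇔ ⟦Nrhs⟧ P Mκ n π
proposition20 P (candP , fixpoint , _) Mκ (candMκ , _ , C∈Mκ) n π =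
  mk⇔ (λ π∈P → Φ⊆⟦Nrhs⟧ candP candMκ n (Equivalence.to (fixpoint n π) π∈P))
      (λ π∈N → Equivalence.from (fixpoint n π) (⟦Nrhs⟧⊆Φ candP C∈Mκ n π∈N))
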